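{- The axiom (Ex) is valid in every Heyting lattice; that is, every Heyting lattice is an Ex-lattice.
   Context: A fundamental lattice is a bounded lattice with unary $\lnot$ that is antitone, satisfies $a\wedge\lnot a=0$ and $a\le\lnot\lnot a$. A Heyting lattice is a distributive fundamental lattice in which $a\wedge b=0$ implies $b\le\lnot a$. (Ex) is the inequality, required for all elements $a,b,c,d,e,f$: $\lnot\big[a\wedge((b\wedge c)\vee(b\wedge d))\big]\wedge a\wedge(c\vee e)\wedge\lnot\lnot f \le \lnot\lnot(a\wedge f)\wedge\big[(a\wedge c)\vee(a\wedge e)\vee f\big]\wedge\big[(b\wedge(c\vee d))\vee\lnot(b\wedge(c\vee d))\big]$. An Ex-lattice is a fundamental lattice satisfying (Ex). -}

module Defs where

open import Level using (Level; suc; _⊔_)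
open import Algebra.Core using (Op₁; Op₂)
open import Algebra.Definitions using (_DistributesOverˡ_)
open import Relation.Binary.Core using (Rel)
open import Relation.Binary.Lattice using (IsBoundedLattice)

record IsFundamentalLattice {c ℓ₁ ℓ₂} {A : Set c}
         (_≈_ : Rel A ℓ₁) (_≤_ : Rel A ℓ₂)
         (_∨_ _∧_ : Op₂ A) (⊤ ⊥ : A) (¬_ : Op₁ A) : Set (c ⊔ ℓ₁ ⊔ ℓ₂) where
  field
    isBoundedLattice : IsBoundedLattice _≈_ _≤_ _∨_ _∧_ ⊤ ⊥
    ¬-antitone       : ∀ {a b} → a ≤ b → (¬ b) ≤ (¬ a)
    ∧-¬              : ∀ a → (a ∧ (¬ a)) ≈ ⊥
    ≤-¬¬             : ∀ a → a ≤ (¬ (¬ a))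

record HeytingLattice c ℓ₁ ℓ₂ : Set (suc (c ⊔ ℓ₁ ⊔ ℓ₂)) where
  infix  4 _≈_ _≤_
  infixr 6 _∨_
  infixr 7 _∧_
  infix  8 ¬_
  field
    Carrier : Set c
    _≈_     : Rel Carrier ℓ₁
    _≤_     : Rel Carrier ℓ₂
    _∨_     : Op₂ Carrier
    _∧_     : Op₂ Carrier
    ⊤       : Carrier
    ⊥       : Carrier
    ¬_      : Op₁ Carrier
    isFundamentalLattice : IsFundamentalLattice _≈_ _≤_ _∨_ _∧_ ⊤ ⊥ ¬_
    ∧-distribˡ-∨ : _DistributesOverˡ_ _≈_ _∧_ _∨_
    pseudocomplement : ∀ {a b} → (a ∧ b) ≈ ⊥ → b ≤ ¬ a

  open IsFundamentalLattice isFundamentalLattice public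

Ex : ∀ {c ℓ₂} {A : Set c} (_≤_ : Rel A ℓ₂)
     (_∨_ _∧_ : Op₂ A) (¬_ : Op₁ A) → Set (c ⊔ ℓ₂)
Ex _≤_ _∨_ _∧_ ¬_ = ∀ a b c d e f →
  ((((¬ (a ∧ ((b ∧ c) ∨ (b ∧ d)))) ∧ a) ∧ (c ∨ e)) ∧ (¬ (¬ f)))
  ≤ (((¬ (¬ (a ∧ f))) ∧ (((a ∧ c) ∨ (a ∧ e)) ∨ f))
      ∧ ((b ∧ (c ∨ d)) ∨ (¬ (b ∧ (c ∨ d)))))

{-# OPTIONS --safe #-}
-- The left-hand side lies below each of the three conjuncts on the right.
-- Since ¬ (a ∧ x) ∧ a ≤ ¬ x for a pseudocomplement, it lies below ¬ (b ∧ (c ∨ d))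
-- once (b ∧ c) ∨ (b ∧ d) is identified with b ∧ (c ∨ d) by distributivity;
-- a ∧ (c ∨ e) is (a ∧ c) ∨ (a ∧ e), again by distributivity; and the same
-- pseudocomplement fact gives a ∧ ¬¬ f ≤ ¬¬ (a ∧ f).
module Submission where

open import Defs
open import Relation.Binary.Lattice using (BoundedLattice)

module HeytingLatticeProperties {c ℓ₁ ℓ₂} (H : HeytingLattice c ℓ₁ ℓ₂) where

  open HeytingLattice H

  boundedLattice : BoundedLattice c ℓ₁ ℓ₂
  boundedLattice = record { isBoundedLattice = isBoundedLattice }

  open BoundedLattice boundedLattice
    using (x∧y≤x; x∧y≤y; ∧-greatest; x≤x∨y; y≤x∨y; minimum; reflexive; antisym; trans;
           refl; module Eq; meetSemilattice; poset)
  open import Relation.Binary.Lattice.Properties.MeetSemilattice meetSemilattice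
    using (∧-monotonic; ∧-assoc)
  open import Relation.Binary.Reasoning.PartialOrder poset

  ¬-cong : ∀ {x y} → x ≈ y → ¬ x ≈ ¬ y
  ¬-cong x≈y = antisym (¬-antitone (reflexive (Eq.sym x≈y))) (¬-antitone (reflexive x≈y))

  ∧≤⊥⇒≤¬ : ∀ {x y} → x ∧ y ≤ ⊥ → y ≤ ¬ x
  ∧≤⊥⇒≤¬ {x} {y} x∧y≤⊥ = pseudocomplement (antisym x∧y≤⊥ (minimum (x ∧ y)))

  ¬[x∧y]∧x≤¬y : ∀ x y → ¬ (x ∧ y) ∧ x ≤ ¬ y
  ¬[x∧y]∧x≤¬y x y = ∧≤⊥⇒≤¬ (begin
    y ∧ ¬ (x ∧ y) ∧ x   ≤⟨ ∧-greatest (∧-greatest (trans (x∧y≤y _ _) (x∧y≤y _ _)) (x∧y≤x _ _))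
                                      (trans (x∧y≤y _ _) (x∧y≤x _ _)) ⟩
    (x ∧ y) ∧ ¬ (x ∧ y) ≈⟨ ∧-¬ (x ∧ y) ⟩
    ⊥                   ∎)

  x∧¬¬y≤¬¬[x∧y] : ∀ x y → x ∧ ¬ ¬ y ≤ ¬ ¬ (x ∧ y)
  x∧¬¬y≤¬¬[x∧y] x y = ∧≤⊥⇒≤¬ (begin
    ¬ (x ∧ y) ∧ x ∧ ¬ ¬ y   ≈⟨ ∧-assoc (¬ (x ∧ y)) x (¬ ¬ y) ⟨
    (¬ (x ∧ y) ∧ x) ∧ ¬ ¬ y ≤⟨ ∧-monotonic (¬[x∧y]∧x≤¬y x y) refl ⟩
    ¬ y ∧ ¬ ¬ y             ≈⟨ ∧-¬ (¬ y) ⟩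
    ⊥                       ∎)

  ex : Ex _≤_ _∨_ _∧_ ¬_
  ex a b c d e f = ∧-greatest (∧-greatest double-negation distribution) excluded-middle
    where
    lhs : Carrier
    lhs = ((¬ (a ∧ ((b ∧ c) ∨ (b ∧ d))) ∧ a) ∧ (c ∨ e)) ∧ ¬ ¬ f

    lhs≤¬[a∧bc∨bd]∧a : lhs ≤ ¬ (a ∧ ((b ∧ c) ∨ (b ∧ d))) ∧ a
    lhs≤¬[a∧bc∨bd]∧a = trans (x∧y≤x _ _) (x∧y≤x _ _)

    lhs≤a : lhs ≤ a
    lhs≤a = trans lhs≤¬[a∧bc∨bd]∧a (x∧y≤y _ _)

    double-negation : lhs ≤ ¬ ¬ (a ∧ f)
    double-negation = begin
      lhs         ≤⟨ ∧-greatest lhs≤a (x∧y≤y _ _) ⟩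
      a ∧ ¬ ¬ f   ≤⟨ x∧¬¬y≤¬¬[x∧y] a f ⟩
      ¬ ¬ (a ∧ f) ∎

    distribution : lhs ≤ ((a ∧ c) ∨ (a ∧ e)) ∨ f
    distribution = begin
      lhs                     ≤⟨ ∧-greatest lhs≤a (trans (x∧y≤x _ _) (x∧y≤y _ _)) ⟩
      a ∧ (c ∨ e)             ≈⟨ ∧-distribˡ-∨ a c e ⟩
      (a ∧ c) ∨ (a ∧ e)       ≤⟨ x≤x∨y _ _ ⟩
      ((a ∧ c) ∨ (a ∧ e)) ∨ f ∎

    excluded-middle : lhs ≤ (b ∧ (c ∨ d)) ∨ ¬ (b ∧ (c ∨ d))
    excluded-middle = begin
      lhs                                  ≤⟨ lhs≤¬[a∧bc∨bd]∧a ⟩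
      ¬ (a ∧ ((b ∧ c) ∨ (b ∧ d))) ∧ a      ≤⟨ ¬[x∧y]∧x≤¬y a _ ⟩
      ¬ ((b ∧ c) ∨ (b ∧ d))                ≈⟨ ¬-cong (∧-distribˡ-∨ b c d) ⟨
      ¬ (b ∧ (c ∨ d))                      ≤⟨ y≤x∨y _ _ ⟩
      (b ∧ (c ∨ d)) ∨ ¬ (b ∧ (c ∨ d))      ∎

lemma3p3 : ∀ {c ℓ₁ ℓ₂} (H : HeytingLattice c ℓ₁ ℓ₂) →
    Ex (HeytingLattice._≤_ H) (HeytingLattice._∨_ H)
       (HeytingLattice._∧_ H) (HeytingLattice.¬_ H)
lemma3p3 H = HeytingLatticeProperties.ex H
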